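{- Let $G$ be a nontrivial connected graph and let $\overline{G}$ denote its complement. Suppose that $\overline{G}$ falls in neither of the following two cases: (i) $\overline{G}$ is connected with $\mathrm{diam}(\overline{G})\in\{2,3\}$; (ii) $\overline{G}$ has exactly two connected components and one of them is trivial (a single vertex). Then $rc(G)\leq 4$. Furthermore, this bound is best possible: there exist connected graphs $G$ satisfying these hypotheses with $rc(G)=4$.
   Context: All graphs are finite, undirected and simple. For an edge-coloring $c:E(G)\to\{1,\dots,k\}$ (adjacent edges may receive the same color), a path is rainbow if no two of its edges have the same color; $G$ is rainbow connected under $c$ if every two vertices are joined by a rainbow path. The rainbow connection number $rc(G)$ of a nontrivial connected graph $G$ is the minimum $k$ for which such a coloring with $k$ colors exists. $\mathrm{diam}(H)$ denotes the diameter of a connected graph $H$, and $\overline{G}$ is the complement of $G$. -}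

module Defs where

open import Data.Nat using (ℕ; zero; suc; _≤_; _+_)
open import Data.Fin using (Fin; _≟_)
open import Data.Bool using (Bool; true; false; not; if_then_else_)
open import Data.List using (List; []; _∷_; length)
open import Data.List.Relation.Unary.Unique.Propositional using (Unique)
open import Data.Product using (Σ; _×_; _,_; ∃; ∃-syntax)
open import Data.Sum using (_⊎_)
open import Relation.Nullary using (¬_; yes; no)
open import Relation.Binary.PropositionalEquality using (_≡_; refl; sym; trans)

record Graph (n : ℕ) : Set where
  field
    adj    : Fin n → Fin n → Bool
    adjSym : ∀ u v → adj u v ≡ adj v u
    adjIrr : ∀ u → adj u u ≡ false
open Graph public

Adj : ∀ {n} → Graph n → Fin n → Fin n → Set
Adj G u v = adj G u v ≡ true

compAdj : ∀ {n} → Graph n → Fin n → Fin n → Bool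
compAdj G u v with u ≟ v
... | yes _ = false
... | no  _ = not (adj G u v)

private
  compSym : ∀ {n} (G : Graph n) u v → compAdj G u v ≡ compAdj G v u
  compSym G u v with u ≟ v | v ≟ u
  ... | yes _ | yes _ = refl
  ... | yes p | no q = Data.Empty.⊥-elim (q (sym p))
    where import Data.Empty
  ... | no q | yes p = Data.Empty.⊥-elim (q (sym p))
    where import Data.Empty
  ... | no _ | no _ rewrite adjSym G u v = refl

  compIrrefl : ∀ {n} (G : Graph n) u → compAdj G u u ≡ false
  compIrrefl G u with u ≟ u
  ... | yes _ = refl
  ... | no q = Data.Empty.⊥-elim (q refl)
    where import Data.Empty

complement : ∀ {n} → Graph n → Graph n
complement G = record { adj = compAdj G ; adjSym = compSym G ; adjIrr = compIrrefl G }

pairs : ∀ {A : Set} → List A → List (A × A)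
pairs (x ∷ y ∷ xs) = (x , y) ∷ pairs (y ∷ xs)
pairs _ = []

data Walk {n} (G : Graph n) : Fin n → Fin n → List (Fin n) → Set where
  here : ∀ {u} → Walk G u u (u ∷ [])
  step : ∀ {u w v ps} → Adj G u w → Walk G w v ps → Walk G u v (u ∷ ps)

IsPath : ∀ {n} → Graph n → Fin n → Fin n → List (Fin n) → Set
IsPath G u v ps = Walk G u v ps × Unique ps

len : ∀ {n} → List (Fin n) → ℕ
len ps = length (pairs ps)

Connected : ∀ {n} → Graph n → Set
Connected G = ∀ u v → ∃[ ps ] IsPath G u v ps

Reach : ∀ {n} → Graph n → Fin n → Fin n → Set
Reach G u v = ∃[ ps ] IsPath G u v ps

Dist : ∀ {n} → Graph n → Fin n → Fin n → ℕ → Set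
Dist G u v d = (∃[ ps ] (IsPath G u v ps × len ps ≡ d))
             × (∀ ps → IsPath G u v ps → d ≤ len ps)

Diam : ∀ {n} → Graph n → ℕ → Set
Diam G d = (∀ u v → ∃[ e ] (Dist G u v e × e ≤ d))
         × (∃[ u ] ∃[ v ] Dist G u v d)

TwoComponentsOneTrivial : ∀ {n} → Graph n → Set
TwoComponentsOneTrivial G =
  ∃[ a ] ∃[ b ] ( ¬ Reach G a b
                × (∀ v → Reach G a v ⊎ Reach G b v)
                × (∀ v → Reach G a v → v ≡ a))

-- Edge colorings with colors from a k-element set. A coloring assigns a
-- color to every (unordered) pair; values on non-edges are irrelevant.
record Coloring {n} (G : Graph n) (k : ℕ) : Set where
  field
    col    : Fin n → Fin n → Fin k
    colSym : ∀ u v → col u v ≡ col v u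
open Coloring public

colorsOf : ∀ {n k} {G : Graph n} → Coloring G k → List (Fin n) → List (Fin k)
colorsOf c [] = []
colorsOf c (x ∷ []) = []
colorsOf c (x ∷ y ∷ xs) = col c x y ∷ colorsOf c (y ∷ xs)

RainbowPath : ∀ {n k} {G : Graph n} → Coloring G k → Fin n → Fin n → List (Fin n) → Set
RainbowPath {G = G} c u v ps = IsPath G u v ps × Unique (colorsOf c ps)

RainbowConnectedUnder : ∀ {n k} {G : Graph n} → Coloring G k → Set
RainbowConnectedUnder c = ∀ u v → ∃[ ps ] RainbowPath c u v ps

RainbowConnectable : ∀ {n} → Graph n → ℕ → Set
RainbowConnectable G k = Σ (Coloring G k) RainbowConnectedUnder

IsRC : ∀ {n} → Graph n → ℕ → Set
IsRC G k = RainbowConnectable G k × (∀ j → RainbowConnectable G j → k ≤ j)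

ComplementHyp : ∀ {n} → Graph n → Set
ComplementHyp G =
  ¬ (Connected (complement G) × (Diam (complement G) 2 ⊎ Diam (complement G) 3))
  × ¬ TwoComponentsOneTrivial (complement G)

-- Let H be the complement of G. If H has an isolated vertex u, the hypothesis
-- excludes that all other vertices are within distance 2 in H, which gives v, a
-- at H-distance at least 3; otherwise H is not connected of diameter 2 or 3, and
-- as G has an edge H is not complete, which gives u, v at H-distance at least 4.
-- Either way the vertices split into {u}, {v}, A, B, C such that uv, Av, Bu, Cu,
-- Cv and all of A × B are edges of G (in the first case A = {a} and B are the
-- H-neighbours of v; in the second A and C are the vertices at H-distance 1 and
-- 2 from u), and colouring every edge by the parts of its ends, as in
-- partColour, makes G rainbow connected with 4 colours.  Rainbow connectivity
-- with a given number of colours is decidable, so rc(G) exists and is at most 4.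
-- Sharpness is witnessed by K_{2,10}, whose complement is K_2 ∪ K_10.

module Submission where

open import Defs
open import Level using (0ℓ)
open import Data.Nat as ℕ using (ℕ; zero; suc; _+_; _*_; _≤_; _<_; _≤?_; z≤n; s≤s)
open import Data.Nat.Properties
  using (≤-refl; ≤-trans; ≤-antisym; ≤-pred; <⇒≤; ≮⇒≥; ≰⇒>; <-irrefl; *-mono-≤; anyUpTo?)
open import Data.Nat.Induction using (<-rec)
open import Data.Fin using (Fin; zero; suc; _≟_; #_; combine)
open import Data.Fin.Properties
  using (any?; all?; injective⇒≤; pigeonhole; combine-injective; <⇒≢; suc-injective)
open import Data.Bool using (Bool; true; false; not; _xor_)
open import Data.Bool.Properties using (xor-comm; xor-same) renaming (_≟_ to _≟ᵇ_)
open import Data.List using (List; []; _∷_; length; lookup)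
open import Data.List.Membership.Propositional.Properties using (∈-lookup)
open import Data.List.Relation.Unary.All as All using ([]; _∷_)
open import Data.List.Relation.Unary.AllPairs using ([]; _∷_)
open import Data.List.Relation.Unary.Unique.Propositional using (Unique)
open import Data.List.Relation.Unary.Unique.DecPropositional using (unique?)
open import Data.Product using (Σ; _×_; _,_; ∃; ∃₂; ∃-syntax; proj₁; proj₂)
open import Data.Sum using (_⊎_; inj₁; inj₂; [_,_]′)
open import Data.Empty using (⊥-elim)
open import Data.Vec.Functional using () renaming (_∷_ to cons)
open import Function using (_∘_)
open import Function.Definitions using (Injective)
open import Relation.Nullary using (¬_; Dec; yes; no; ¬?)
open import Relation.Nullary.Decidable using (_×-dec_; _⊎-dec_; decidable-stable)
open import Relation.Unary using (Pred; Decidable)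
open import Relation.Binary.PropositionalEquality
  using (_≡_; _≢_; refl; sym; trans; cong; cong₂; subst; subst₂)

module _ {n : ℕ} (G : Graph n) where

  adj-sym : ∀ {x y} → Adj G x y → Adj G y x
  adj-sym {x} {y} = trans (adjSym G y x)

  adj⇒≢ : ∀ {x y} → Adj G x y → x ≢ y
  adj⇒≢ {x} xy refl with () ← trans (sym (adjIrr G x)) xy

  path₀ : ∀ x → IsPath G x x (x ∷ [])
  path₀ x = here , [] ∷ []

  path₁ : ∀ {x y} → Adj G x y → IsPath G x y (x ∷ y ∷ [])
  path₁ xy = step xy here , (adj⇒≢ xy ∷ []) ∷ [] ∷ []

  path₂ : ∀ {x m y} → Adj G x m → Adj G m y → x ≢ y → IsPath G x y (x ∷ m ∷ y ∷ [])
  path₂ xm my x≢y = step xm (step my here) , (adj⇒≢ xm ∷ x≢y ∷ []) ∷ (adj⇒≢ my ∷ []) ∷ [] ∷ []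

  path₃ : ∀ {x m p y} → Adj G x m → Adj G m p → Adj G p y → x ≢ p → x ≢ y → m ≢ y →
          IsPath G x y (x ∷ m ∷ p ∷ y ∷ [])
  path₃ xm mp py x≢p x≢y m≢y =
    step xm (step mp (step py here)) ,
    (adj⇒≢ xm ∷ x≢p ∷ x≢y ∷ []) ∷ (adj⇒≢ mp ∷ m≢y ∷ []) ∷ (adj⇒≢ py ∷ []) ∷ [] ∷ []

  path₄ : ∀ {x m p q y} → Adj G x m → Adj G m p → Adj G p q → Adj G q y →
          x ≢ p → x ≢ q → x ≢ y → m ≢ q → m ≢ y → p ≢ y → IsPath G x y (x ∷ m ∷ p ∷ q ∷ y ∷ [])
  path₄ xm mp pq qy x≢p x≢q x≢y m≢q m≢y p≢y =
    step xm (step mp (step pq (step qy here))) ,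
    (adj⇒≢ xm ∷ x≢p ∷ x≢q ∷ x≢y ∷ []) ∷ (adj⇒≢ mp ∷ m≢q ∷ m≢y ∷ []) ∷
    (adj⇒≢ pq ∷ p≢y ∷ []) ∷ (adj⇒≢ qy ∷ []) ∷ [] ∷ []

  module _ {k : ℕ} (c : Coloring G k) where

    rainbow₀ : ∀ x → RainbowPath c x x (x ∷ [])
    rainbow₀ x = path₀ x , []

    rainbow₁ : ∀ {x y} → Adj G x y → RainbowPath c x y (x ∷ y ∷ [])
    rainbow₁ xy = path₁ xy , [] ∷ []

    rainbow₂ : ∀ {x m y} → Adj G x m → Adj G m y → x ≢ y →
               col c x m ≢ col c m y → RainbowPath c x y (x ∷ m ∷ y ∷ [])
    rainbow₂ xm my x≢y c₁≢c₂ = path₂ xm my x≢y , (c₁≢c₂ ∷ []) ∷ [] ∷ []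

    rainbow₃ : ∀ {x m p y} → Adj G x m → Adj G m p → Adj G p y →
               x ≢ p → x ≢ y → m ≢ y →
               col c x m ≢ col c m p → col c x m ≢ col c p y → col c m p ≢ col c p y →
               RainbowPath c x y (x ∷ m ∷ p ∷ y ∷ [])
    rainbow₃ xm mp py x≢p x≢y m≢y c₁≢c₂ c₁≢c₃ c₂≢c₃ =
      path₃ xm mp py x≢p x≢y m≢y , (c₁≢c₂ ∷ c₁≢c₃ ∷ []) ∷ (c₂≢c₃ ∷ []) ∷ [] ∷ []

    rainbow₄ : ∀ {x m p q y} → Adj G x m → Adj G m p → Adj G p q → Adj G q y →
               x ≢ p → x ≢ q → x ≢ y → m ≢ q → m ≢ y → p ≢ y →
               col c x m ≢ col c m p → col c x m ≢ col c p q → col c x m ≢ col c q y →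
               col c m p ≢ col c p q → col c m p ≢ col c q y → col c p q ≢ col c q y →
               RainbowPath c x y (x ∷ m ∷ p ∷ q ∷ y ∷ [])
    rainbow₄ xm mp pq qy x≢p x≢q x≢y m≢q m≢y p≢y c₁≢c₂ c₁≢c₃ c₁≢c₄ c₂≢c₃ c₂≢c₄ c₃≢c₄ =
      path₄ xm mp pq qy x≢p x≢q x≢y m≢q m≢y p≢y ,
      (c₁≢c₂ ∷ c₁≢c₃ ∷ c₁≢c₄ ∷ []) ∷ (c₂≢c₃ ∷ c₂≢c₄ ∷ []) ∷ (c₃≢c₄ ∷ []) ∷ [] ∷ []

data Part : Set where
  U V A B C : Part

label : Part → Bool × Bool
label U = false , false
label V = false , true
label A = false , true
label B = true  , false
label C = true  , true

toFin : Bool × Bool → Fin 4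
toFin (false , false) = # 0
toFin (false , true)  = # 1
toFin (true  , false) = # 2
toFin (true  , true)  = # 3

-- Labels are chosen so that the paths U V A, V U B, A V C, B U C, C U V C,
-- A V U B A and B U V A B below all receive distinct colours.
partColour : Part → Part → Fin 4
partColour X Y = toFin (proj₁ (label X) xor proj₁ (label Y) , proj₂ (label X) xor proj₂ (label Y))

partColour-comm : ∀ X Y → partColour X Y ≡ partColour Y X
partColour-comm X Y = cong toFin (cong₂ _,_ (xor-comm (proj₁ (label X)) _) (xor-comm (proj₂ (label X)) _))

record Frame {n : ℕ} (G : Graph n) : Set where
  field
    u v    : Fin n
    part   : Fin n → Part
    U⇒≡u   : ∀ {x} → part x ≡ U → x ≡ u
    V⇒≡v   : ∀ {x} → part x ≡ V → x ≡ v
    part-u : part u ≡ U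
    part-v : part v ≡ V
    adj-uv : Adj G u v
    adj-Av : ∀ {x} → part x ≡ A → Adj G x v
    adj-AB : ∀ {x y} → part x ≡ A → part y ≡ B → Adj G x y
    adj-Bu : ∀ {y} → part y ≡ B → Adj G y u
    adj-Cu : ∀ {z} → part z ≡ C → Adj G z u
    adj-Cv : ∀ {z} → part z ≡ C → Adj G z v
    two-A⇒B : ∀ {x y} → part x ≡ A → part y ≡ A → x ≢ y → ∃ λ b → part b ≡ B
    two-B⇒A : ∀ {x y} → part x ≡ B → part y ≡ B → x ≢ y → ∃ λ a → part a ≡ A

module _ {n : ℕ} {G : Graph n} (F : Frame G) where
  open Frame F

  frameColouring : Coloring G 4
  frameColouring = record
    { col    = λ x y → partColour (part x) (part y)
    ; colSym = λ x y → partColour-comm (part x) (part y)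
    }

  private
    c = frameColouring

    parts-≢ : ∀ {x y X Y} → part x ≡ X → part y ≡ Y → X ≢ Y → x ≢ y
    parts-≢ px py X≢Y refl = X≢Y (trans (sym px) py)

    colours-≢ : ∀ {x y p q W X Y Z} → part x ≡ W → part y ≡ X → part p ≡ Y → part q ≡ Z →
                partColour W X ≢ partColour Y Z → col c x y ≢ col c p q
    colours-≢ refl refl refl refl W≢X = W≢X

    edgeUV : ∀ {x y} → part x ≡ U → part y ≡ V → Adj G x y
    edgeUV px py = subst₂ (Adj G) (sym (U⇒≡u px)) (sym (V⇒≡v py)) adj-uv

    edgeUB : ∀ {x y} → part x ≡ U → part y ≡ B → Adj G x y
    edgeUB px py = subst (λ x → Adj G x _) (sym (U⇒≡u px)) (adj-sym G (adj-Bu py))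

    edgeUC : ∀ {x y} → part x ≡ U → part y ≡ C → Adj G x y
    edgeUC px py = subst (λ x → Adj G x _) (sym (U⇒≡u px)) (adj-sym G (adj-Cu py))

    edgeVA : ∀ {x y} → part x ≡ V → part y ≡ A → Adj G x y
    edgeVA px py = subst (λ x → Adj G x _) (sym (V⇒≡v px)) (adj-sym G (adj-Av py))

    edgeVC : ∀ {x y} → part x ≡ V → part y ≡ C → Adj G x y
    edgeVC px py = subst (λ x → Adj G x _) (sym (V⇒≡v px)) (adj-sym G (adj-Cv py))

    path-CC : ∀ {x y} → part x ≡ C → part y ≡ C → x ≢ y → RainbowPath c x y (x ∷ u ∷ v ∷ y ∷ [])
    path-CC px py x≢y =
      rainbow₃ G c (adj-sym G (edgeUC part-u px)) (edgeUV part-u part-v) (edgeVC part-v py)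
        (parts-≢ px part-v λ ()) x≢y (parts-≢ part-u py λ ())
        (colours-≢ px part-u part-u part-v λ ()) (colours-≢ px part-u part-v py λ ())
        (colours-≢ part-u part-v part-v py λ ())

    path-AA : ∀ {x y b} → part x ≡ A → part y ≡ A → part b ≡ B → x ≢ y →
              RainbowPath c x y (x ∷ v ∷ u ∷ b ∷ y ∷ [])
    path-AA px py pb x≢y =
      rainbow₄ G c (adj-sym G (edgeVA part-v px)) (adj-sym G (edgeUV part-u part-v))
        (edgeUB part-u pb) (adj-sym G (adj-AB py pb))
        (parts-≢ px part-u λ ()) (parts-≢ px pb λ ()) x≢y
        (parts-≢ part-v pb λ ()) (parts-≢ part-v py λ ()) (parts-≢ part-u py λ ())
        (colours-≢ px part-v part-v part-u λ ()) (colours-≢ px part-v part-u pb λ ())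
        (colours-≢ px part-v pb py λ ()) (colours-≢ part-v part-u part-u pb λ ())
        (colours-≢ part-v part-u pb py λ ()) (colours-≢ part-u pb pb py λ ())

    path-BB : ∀ {x y a} → part x ≡ B → part y ≡ B → part a ≡ A → x ≢ y →
              RainbowPath c x y (x ∷ u ∷ v ∷ a ∷ y ∷ [])
    path-BB px py pa x≢y =
      rainbow₄ G c (adj-sym G (edgeUB part-u px)) (edgeUV part-u part-v)
        (edgeVA part-v pa) (adj-AB pa py)
        (parts-≢ px part-v λ ()) (parts-≢ px pa λ ()) x≢y
        (parts-≢ part-u pa λ ()) (parts-≢ part-u py λ ()) (parts-≢ part-v py λ ())
        (colours-≢ px part-u part-u part-v λ ()) (colours-≢ px part-u part-v pa λ ())
        (colours-≢ px part-u pa py λ ()) (colours-≢ part-u part-v part-v pa λ ())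
        (colours-≢ part-u part-v pa py λ ()) (colours-≢ part-v pa pa py λ ())

  frame-rainbowConnected : RainbowConnectedUnder frameColouring
  frame-rainbowConnected x y with x ≟ y
  ... | yes refl = _ , rainbow₀ G c x
  ... | no x≢y with part x in px | part y in py
  ... | U | U = ⊥-elim (x≢y (trans (U⇒≡u px) (sym (U⇒≡u py))))
  ... | V | V = ⊥-elim (x≢y (trans (V⇒≡v px) (sym (V⇒≡v py))))
  ... | U | V = _ , rainbow₁ G c (edgeUV px py)
  ... | V | U = _ , rainbow₁ G c (adj-sym G (edgeUV py px))
  ... | U | B = _ , rainbow₁ G c (edgeUB px py)
  ... | B | U = _ , rainbow₁ G c (adj-sym G (edgeUB py px))
  ... | U | C = _ , rainbow₁ G c (edgeUC px py)
  ... | C | U = _ , rainbow₁ G c (adj-sym G (edgeUC py px))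
  ... | V | A = _ , rainbow₁ G c (edgeVA px py)
  ... | A | V = _ , rainbow₁ G c (adj-sym G (edgeVA py px))
  ... | V | C = _ , rainbow₁ G c (edgeVC px py)
  ... | C | V = _ , rainbow₁ G c (adj-sym G (edgeVC py px))
  ... | A | B = _ , rainbow₁ G c (adj-AB px py)
  ... | B | A = _ , rainbow₁ G c (adj-sym G (adj-AB py px))
  ... | U | A = _ , rainbow₂ G c (edgeUV px part-v) (edgeVA part-v py) x≢y
                      (colours-≢ px part-v part-v py λ ())
  ... | A | U = _ , rainbow₂ G c (adj-sym G (edgeVA part-v px)) (adj-sym G (edgeUV py part-v)) x≢y
                      (colours-≢ px part-v part-v py λ ())
  ... | V | B = _ , rainbow₂ G c (adj-sym G (edgeUV part-u px)) (edgeUB part-u py) x≢y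
                      (colours-≢ px part-u part-u py λ ())
  ... | B | V = _ , rainbow₂ G c (adj-sym G (edgeUB part-u px)) (edgeUV part-u py) x≢y
                      (colours-≢ px part-u part-u py λ ())
  ... | A | C = _ , rainbow₂ G c (adj-sym G (edgeVA part-v px)) (edgeVC part-v py) x≢y
                      (colours-≢ px part-v part-v py λ ())
  ... | C | A = _ , rainbow₂ G c (adj-sym G (edgeVC part-v px)) (edgeVA part-v py) x≢y
                      (colours-≢ px part-v part-v py λ ())
  ... | B | C = _ , rainbow₂ G c (adj-sym G (edgeUB part-u px)) (edgeUC part-u py) x≢y
                      (colours-≢ px part-u part-u py λ ())
  ... | C | B = _ , rainbow₂ G c (adj-sym G (edgeUC part-u px)) (edgeUB part-u py) x≢y
                      (colours-≢ px part-u part-u py λ ())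
  ... | C | C = _ , path-CC px py x≢y
  ... | A | A = let (b , pb) = two-A⇒B px py x≢y in _ , path-AA px py pb x≢y
  ... | B | B = let (a , pa) = two-B⇒A px py x≢y in _ , path-BB px py pa x≢y

  frame-rainbowConnectable : RainbowConnectable G 4
  frame-rainbowConnectable = frameColouring , frame-rainbowConnected

lookup-injective : ∀ {X : Set} {xs : List X} → Unique xs → Injective _≡_ _≡_ (lookup xs)
lookup-injective {xs = _ ∷ _} (_ ∷ _) {zero} {zero} _ = refl
lookup-injective {xs = _ ∷ _} (x∉ ∷ _) {zero} {suc j} eq = ⊥-elim (All.lookup x∉ (∈-lookup j) eq)
lookup-injective {xs = _ ∷ _} (x∉ ∷ _) {suc i} {zero} eq = ⊥-elim (All.lookup x∉ (∈-lookup i) (sym eq))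
lookup-injective {xs = _ ∷ _} (_ ∷ xs!) {suc i} {suc j} eq = cong suc (lookup-injective xs! eq)

Unique⇒length≤ : ∀ {n} {xs : List (Fin n)} → Unique xs → length xs ≤ n
Unique⇒length≤ xs! = injective⇒≤ (lookup-injective xs!)

module _ {n : ℕ} (G : Graph n) where

  adj? : ∀ x y → Dec (Adj G x y)
  adj? x y = adj G x y ≟ᵇ true

  private
    walk-head : ∀ {x y z ps} → Walk G x y (z ∷ ps) → x ≡ z
    walk-head here       = refl
    walk-head (step _ _) = refl

  walk? : ∀ x y ps → Dec (Walk G x y ps)
  walk? x y [] = no λ ()
  walk? x y (z ∷ []) with z ≟ x | x ≟ y
  ... | yes refl | yes refl = yes here
  ... | yes refl | no x≢y   = no λ { here → x≢y refl ; (step _ ()) }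
  ... | no z≢x   | _        = no λ { here → z≢x refl ; (step _ ()) }
  walk? x y (z ∷ w ∷ ps) with z ≟ x | adj? z w | walk? w y (w ∷ ps)
  ... | no z≢x   | _      | _        = no λ { (step _ _) → z≢x refl }
  ... | yes refl | yes zw | yes walk = yes (step zw walk)
  ... | yes refl | no ¬zw | _        =
    no λ { (step zw′ walk) → ¬zw (subst (Adj G z) (walk-head walk) zw′) }
  ... | yes refl | yes _  | no ¬walk =
    no λ { (step _ walk) → ¬walk (subst (λ t → Walk G t y (w ∷ ps)) (walk-head walk) walk) }

  exists-list≤? : ∀ m {P : Pred (List (Fin n)) 0ℓ} → Decidable P →
                  Dec (∃ λ xs → length xs ≤ m × P xs)
  exists-list≤? m P? with P? []
  ... | yes p[] = yes ([] , z≤n , p[])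
  exists-list≤? zero P? | no ¬p[] = no λ { ([] , _ , p) → ¬p[] p ; (_ ∷ _ , () , _) }
  exists-list≤? (suc m) P? | no ¬p[] with any? (λ x → exists-list≤? m (λ xs → P? (x ∷ xs)))
  ... | yes (x , xs , l , p) = yes (x ∷ xs , s≤s l , p)
  ... | no ¬p∷ = no λ { ([] , _ , p) → ¬p[] p ; (x ∷ xs , s≤s l , p) → ¬p∷ (x , xs , l , p) }

  module _ {k : ℕ} (c : Coloring G k) where

    rainbowPath? : ∀ x y ps → Dec (RainbowPath c x y ps)
    rainbowPath? x y ps = (walk? x y ps ×-dec unique? _≟_ ps) ×-dec unique? _≟_ (colorsOf c ps)

    rainbowConnected? : Dec (RainbowConnectedUnder c)
    rainbowConnected? = all? λ x → all? λ y → exists-rainbowPath? x y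
      where
      exists-rainbowPath? : ∀ x y → Dec (∃ λ ps → RainbowPath c x y ps)
      exists-rainbowPath? x y with exists-list≤? n (rainbowPath? x y)
      ... | yes (ps , _ , rp) = yes (ps , rp)
      ... | no ¬short = no λ { (ps , rp) → ¬short (ps , Unique⇒length≤ (proj₂ (proj₁ rp)) , rp) }

colorsOf-cong : ∀ {n k} {G : Graph n} {c d : Coloring G k} → (∀ x y → col c x y ≡ col d x y) →
                ∀ ps → colorsOf c ps ≡ colorsOf d ps
colorsOf-cong c≗d []           = refl
colorsOf-cong c≗d (x ∷ [])     = refl
colorsOf-cong c≗d (x ∷ y ∷ ps) = cong₂ _∷_ (c≗d x y) (colorsOf-cong c≗d (y ∷ ps))

rainbowConnected-cong : ∀ {n k} {G : Graph n} {c d : Coloring G k} → (∀ x y → col c x y ≡ col d x y) →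
                        RainbowConnectedUnder c → RainbowConnectedUnder d
rainbowConnected-cong c≗d rc x y =
  let (ps , path , colours!) = rc x y in ps , path , subst Unique (colorsOf-cong c≗d ps) colours!

length-colorsOf : ∀ {n k} {G : Graph n} (c : Coloring G k) ps → length (colorsOf c ps) ≡ len ps
length-colorsOf c []           = refl
length-colorsOf c (x ∷ [])     = refl
length-colorsOf c (x ∷ y ∷ ps) = cong suc (length-colorsOf c (y ∷ ps))

-- Without function extensionality, only predicates respecting the chosen
-- equality can be searched.
Searchable : (X : Set) → (X → X → Set) → Set₁
Searchable X _≈_ = (Q : X → Set) → (∀ {a b} → a ≈ b → Q a → Q b) → (∀ a → Dec (Q a)) → Dec (∃ Q)

Fin-searchable : ∀ k → Searchable (Fin k) _≡_
Fin-searchable k Q _ Q? = any? Q?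

Π-searchable : ∀ {X : Set} {_≈_ : X → X → Set} → (∀ a → a ≈ a) → Searchable X _≈_ →
               ∀ m → Searchable (Fin m → X) (λ f g → ∀ i → f i ≈ g i)
Π-searchable refl≈ search zero Q resp Q? with Q? (λ ())
... | yes q = yes (_ , q)
... | no ¬q = no λ { (f , q) → ¬q (resp (λ ()) q) }
Π-searchable {X} {_≈_} refl≈ search (suc m) Q resp Q?
  with search (λ a → ∃ λ f → Q (cons a f)) resp-head
         (λ a → Π-searchable refl≈ search m (Q ∘ cons a) (resp-tail a) (Q? ∘ cons a))
  where
  resp-head : ∀ {a b} → a ≈ b → ∃ (Q ∘ cons a) → ∃ (Q ∘ cons b)
  resp-head a≈b (f , q) = f , resp (λ { zero → a≈b ; (suc i) → refl≈ (f i) }) q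
  resp-tail : ∀ a {f g} → (∀ i → f i ≈ g i) → Q (cons a f) → Q (cons a g)
  resp-tail a f≈g = resp λ { zero → refl≈ a ; (suc i) → f≈g i }
... | yes (a , f , q) = yes (_ , q)
... | no ¬q =
  no λ { (f , q) → ¬q (f zero , (f ∘ suc) , resp (λ { zero → refl≈ (f zero) ; (suc i) → refl≈ (f (suc i)) }) q) }

rainbowConnectable? : ∀ {n} (G : Graph n) k → Dec (RainbowConnectable G k)
rainbowConnectable? {n} G k
  with Π-searchable (λ f i → refl) (Π-searchable (λ a → refl) (Fin-searchable k) n) n Good resp good?
  where
  colouring : (f : Fin n → Fin n → Fin k) → (∀ x y → f x y ≡ f y x) → Coloring G k
  colouring f f-sym = record { col = f ; colSym = f-sym }
  Good : (Fin n → Fin n → Fin k) → Set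
  Good f = Σ (∀ x y → f x y ≡ f y x) λ f-sym → RainbowConnectedUnder (colouring f f-sym)
  resp : ∀ {f g} → (∀ x y → f x y ≡ g x y) → Good f → Good g
  resp f≗g (f-sym , rc) = g-sym , rainbowConnected-cong f≗g rc
    where
    g-sym = λ x y → trans (sym (f≗g x y)) (trans (f-sym x y) (f≗g y x))
  good? : ∀ f → Dec (Good f)
  good? f with all? (λ x → all? λ y → f x y ≟ f y x)
  ... | no ¬sym = no λ (f-sym , _) → ¬sym λ x y → f-sym x y
  ... | yes f-sym with rainbowConnected? G (colouring f f-sym)
  ... | yes rc = yes (f-sym , rc)
  ... | no ¬rc = no λ (_ , rc) → ¬rc (rainbowConnected-cong (λ _ _ → refl) rc)
... | yes (f , f-sym , rc) = yes (_ , rc)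
... | no ¬good = no λ (c , rc) → ¬good (col c , colSym c , rc)

Least : Pred ℕ 0ℓ → ℕ → Set
Least P k = P k × (∀ j → P j → k ≤ j)

least≤ : ∀ {P : Pred ℕ 0ℓ} → Decidable P → ∀ {m} → P m → ∃ λ k → Least P k × k ≤ m
least≤ {P} P? = <-rec (λ m → P m → ∃ λ k → Least P k × k ≤ m) go _
  where
  go : ∀ m → (∀ {j} → j < m → P j → ∃ λ k → Least P k × k ≤ j) → P m → ∃ λ k → Least P k × k ≤ m
  go m below pm with anyUpTo? P? m
  ... | no none            = m , (pm , λ j pj → ≮⇒≥ λ j<m → none (j , j<m , pj)) , ≤-refl
  ... | yes (j , j<m , pj) = let (k , least , k≤j) = below j<m pj in k , least , ≤-trans k≤j (<⇒≤ j<m)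

rc≤ : ∀ {n m} (G : Graph n) → RainbowConnectable G m → ∃ λ k → IsRC G k × k ≤ m
rc≤ G = least≤ (rainbowConnectable? G)

isRC-exact : ∀ {n m} {G : Graph n} → (∃ λ k → IsRC G k × k ≤ m) → (∀ j → RainbowConnectable G j → m ≤ j) →
             IsRC G m
isRC-exact {G = G} (k , rc[G]≡k , k≤m) lower =
  subst (IsRC G) (≤-antisym k≤m (lower k (proj₁ rc[G]≡k))) rc[G]≡k

module _ {n : ℕ} (K : Graph n) where

  Within₂ : Fin n → Fin n → Set
  Within₂ x y = x ≡ y ⊎ Adj K x y ⊎ ∃ λ w → Adj K x w × Adj K w y

  Walk₃ : Fin n → Fin n → Set
  Walk₃ x y = ∃₂ λ w z → Adj K x w × Adj K w z × Adj K z y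

  Within₃ : Fin n → Fin n → Set
  Within₃ x y = Within₂ x y ⊎ Walk₃ x y

  within₂? : ∀ x y → Dec (Within₂ x y)
  within₂? x y = x ≟ y ⊎-dec adj? K x y ⊎-dec any? λ w → adj? K x w ×-dec adj? K w y

  within₃? : ∀ x y → Dec (Within₃ x y)
  within₃? x y = within₂? x y ⊎-dec any? λ w → any? λ z → adj? K x w ×-dec adj? K w z ×-dec adj? K z y

  short-walk₀ : ∀ {x y ps} → Walk K x y ps → len ps < 1 → x ≡ y
  short-walk₀ here                _ = refl
  short-walk₀ (step _ here)       (s≤s ())
  short-walk₀ (step _ (step _ _)) (s≤s ())

  short-walk₁ : ∀ {x y ps} → Walk K x y ps → len ps < 2 → x ≡ y ⊎ Adj K x y
  short-walk₁ here                         _ = inj₁ refl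
  short-walk₁ (step xy here)               _ = inj₂ xy
  short-walk₁ (step _ (step _ here))       (s≤s (s≤s ()))
  short-walk₁ (step _ (step _ (step _ _))) (s≤s (s≤s ()))

  short-walk₂ : ∀ {x y ps} → Walk K x y ps → len ps < 3 → Within₂ x y
  short-walk₂ here                                  _ = inj₁ refl
  short-walk₂ (step xy here)                        _ = inj₂ (inj₁ xy)
  short-walk₂ (step xw (step wy here))              _ = inj₂ (inj₂ (_ , xw , wy))
  short-walk₂ (step _ (step _ (step _ here)))       (s≤s (s≤s (s≤s ())))
  short-walk₂ (step _ (step _ (step _ (step _ _)))) (s≤s (s≤s (s≤s ())))

  dist-refl : ∀ x → Dist K x x 0
  dist-refl x = (_ , path₀ K x , refl) , λ _ _ → z≤n

  dist-adj : ∀ {x y} → Adj K x y → Dist K x y 1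
  dist-adj xy = (_ , path₁ K xy , refl) , λ _ (walk , _) → ≮⇒≥ (adj⇒≢ K xy ∘ short-walk₀ walk)

  dist-2 : ∀ {x y} → ¬ (x ≡ y ⊎ Adj K x y) → ∃ (λ w → Adj K x w × Adj K w y) → Dist K x y 2
  dist-2 far (w , xw , wy) =
    (_ , path₂ K xw wy (far ∘ inj₁) , refl) , λ _ (walk , _) → ≮⇒≥ (far ∘ short-walk₁ walk)

  dist-3 : ∀ {x y} → ¬ Within₂ x y → Walk₃ x y → Dist K x y 3
  dist-3 {x} {y} far (w , z , xw , wz , zy) =
    (_ , path₃ K xw wz zy x≢z (far ∘ inj₁) w≢y , refl) , λ _ (walk , _) → ≮⇒≥ (far ∘ short-walk₂ walk)
    where
    x≢z : x ≢ z
    x≢z refl = far (inj₂ (inj₁ zy))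
    w≢y : w ≢ y
    w≢y refl = far (inj₂ (inj₁ xw))

  within₂⇒dist : ∀ {x y} → Within₂ x y → ∃ λ e → Dist K x y e × e ≤ 2
  within₂⇒dist {x} {y} near with x ≟ y | adj? K x y | near
  ... | yes refl | _      | _               = 0 , dist-refl x , z≤n
  ... | no _     | yes xy | _               = 1 , dist-adj xy , s≤s z≤n
  ... | no x≢y   | no _   | inj₁ x≡y        = ⊥-elim (x≢y x≡y)
  ... | no _     | no ¬xy | inj₂ (inj₁ xy)  = ⊥-elim (¬xy xy)
  ... | no x≢y   | no ¬xy | inj₂ (inj₂ xwy) = 2 , dist-2 [ x≢y , ¬xy ]′ xwy , ≤-refl

  within₃⇒dist : ∀ {x y} → Within₃ x y → ∃ λ e → Dist K x y e × e ≤ 3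
  within₃⇒dist {x} {y} near with within₂? x y | near
  ... | yes near₂ | _          =
    let (e , d , e≤2) = within₂⇒dist near₂ in e , d , ≤-trans e≤2 (s≤s (s≤s z≤n))
  ... | no far    | inj₁ near₂ = ⊥-elim (far near₂)
  ... | no far    | inj₂ walk  = 3 , dist-3 far walk , ≤-refl

  dist⇒reach : ∀ {x y e} → Dist K x y e → Reach K x y
  dist⇒reach ((ps , path , _) , _) = ps , path

module _ {n : ℕ} (G : Graph n) where

  complement-adj : ∀ {x y} → x ≢ y → adj G x y ≡ false → Adj (complement G) x y
  complement-adj {x} {y} x≢y ¬xy with x ≟ y
  ... | yes x≡y = ⊥-elim (x≢y x≡y)
  ... | no _ rewrite ¬xy = refl

  complement-adj⁻ : ∀ {x y} → Adj (complement G) x y → adj G x y ≡ false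
  complement-adj⁻ {x} {y} xy with x ≟ y
  complement-adj⁻ () | yes _
  ... | no _ with adj G x y
  ...   | false = refl
  complement-adj⁻ () | no _ | true

  ¬complement⇒adj : ∀ {x y} → x ≢ y → ¬ Adj (complement G) x y → Adj G x y
  ¬complement⇒adj {x} {y} x≢y ¬xy with adj G x y in e
  ... | true  = refl
  ... | false = ⊥-elim (¬xy (complement-adj x≢y e))

Isolated : ∀ {n} → Graph n → Fin n → Set
Isolated K u = ∀ x → ¬ Adj K u x

isolated-reach : ∀ {n} {K : Graph n} {u x} → Isolated K u → Reach K u x → x ≡ u
isolated-reach u-iso (_ , here , _)     = refl
isolated-reach u-iso (_ , step ux _ , _) = ⊥-elim (u-iso _ ux)

module IsolatedVertex {n : ℕ} (G : Graph n) (u : Fin n) (u-iso : Isolated (complement G) u)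
                      (v a : Fin n) (v≢u : v ≢ u) (a≢u : a ≢ u) (far : ¬ Within₂ (complement G) v a) where

  private
    H = complement G

    Spec : Fin n → Part → Set
    Spec x U = x ≡ u
    Spec x V = x ≡ v × x ≢ u
    Spec x A = x ≡ a × x ≢ u × x ≢ v
    Spec x B = Adj H v x × x ≢ u × x ≢ v × x ≢ a
    Spec x C = ¬ Adj H v x × x ≢ u × x ≢ v × x ≢ a

    classify : ∀ x → Σ Part (Spec x)
    classify x with x ≟ u | x ≟ v | x ≟ a | adj? H v x
    ... | yes x≡u | _       | _       | _     = U , x≡u
    ... | no x≢u  | yes x≡v | _       | _     = V , x≡v , x≢u
    ... | no x≢u  | no x≢v  | yes x≡a | _     = A , x≡a , x≢u , x≢v
    ... | no x≢u  | no x≢v  | no x≢a  | yes vx = B , vx , x≢u , x≢v , x≢a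
    ... | no x≢u  | no x≢v  | no x≢a  | no ¬vx = C , ¬vx , x≢u , x≢v , x≢a

    part : Fin n → Part
    part x = proj₁ (classify x)

    spec : ∀ {x X} → part x ≡ X → Spec x X
    spec {x} eq = subst (Spec x) eq (proj₂ (classify x))

    part-u : part u ≡ U
    part-u with classify u
    ... | U , _ = refl
    ... | V , _ , u≢u         = ⊥-elim (u≢u refl)
    ... | A , _ , u≢u , _     = ⊥-elim (u≢u refl)
    ... | B , _ , u≢u , _     = ⊥-elim (u≢u refl)
    ... | C , _ , u≢u , _     = ⊥-elim (u≢u refl)

    part-v : part v ≡ V
    part-v with classify v
    ... | U , v≡u = ⊥-elim (v≢u v≡u)
    ... | V , _ = refl
    ... | A , _ , _ , v≢v     = ⊥-elim (v≢v refl)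
    ... | B , _ , _ , v≢v , _ = ⊥-elim (v≢v refl)
    ... | C , _ , _ , v≢v , _ = ⊥-elim (v≢v refl)

    part-a : part a ≡ A
    part-a with classify a
    ... | U , a≡u = ⊥-elim (a≢u a≡u)
    ... | V , a≡v , _ = ⊥-elim (far (inj₁ (sym a≡v)))
    ... | A , _ = refl
    ... | B , _ , _ , _ , a≢a = ⊥-elim (a≢a refl)
    ... | C , _ , _ , _ , a≢a = ⊥-elim (a≢a refl)

    adj-av : Adj G a v
    adj-av = ¬complement⇒adj G (far ∘ inj₁ ∘ sym) (far ∘ inj₂ ∘ inj₁ ∘ adj-sym H {a} {v})

  frame : Frame G
  frame = record
    { u = u ; v = v ; part = part
    ; U⇒≡u = spec
    ; V⇒≡v = proj₁ ∘ spec
    ; part-u = part-u ; part-v = part-v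
    ; adj-uv = ¬complement⇒adj G (v≢u ∘ sym) (u-iso v)
    ; adj-Av = λ px → subst (λ x → Adj G x v) (sym (proj₁ (spec px))) adj-av
    ; adj-AB = λ {x} {y} px py → let (vy , _ , _ , y≢a) = spec py in
        subst (λ x → Adj G x y) (sym (proj₁ (spec px)))
          (¬complement⇒adj G (y≢a ∘ sym) λ ay → far (inj₂ (inj₂ (y , vy , adj-sym H {a} {y} ay))))
    ; adj-Bu = λ {y} py → let (_ , y≢u , _) = spec py in ¬complement⇒adj G y≢u (u-iso y ∘ adj-sym H {y} {u})
    ; adj-Cu = λ {z} pz → let (_ , z≢u , _) = spec pz in ¬complement⇒adj G z≢u (u-iso z ∘ adj-sym H {z} {u})
    ; adj-Cv = λ {z} pz → let (¬vz , _ , z≢v , _) = spec pz in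
        ¬complement⇒adj G z≢v (¬vz ∘ adj-sym H {z} {v})
    ; two-A⇒B = λ px py x≢y → ⊥-elim (x≢y (trans (proj₁ (spec px)) (sym (proj₁ (spec py)))))
    ; two-B⇒A = λ _ _ _ → a , part-a
    }

module FarPair {n : ℕ} (G : Graph n) (u v : Fin n) (far : ¬ Within₃ (complement G) u v)
               (neighbour : ∀ x → ∃ λ y → Adj (complement G) x y) where

  private
    H = complement G

    Spec : Fin n → Part → Set
    Spec x U = x ≡ u
    Spec x V = x ≡ v × x ≢ u
    Spec x A = Adj H u x × x ≢ u × x ≢ v
    Spec x C = ¬ Adj H u x × (∃ λ w → Adj H u w × Adj H w x) × x ≢ u × x ≢ v
    Spec x B = ¬ Adj H u x × ¬ (∃ λ w → Adj H u w × Adj H w x) × x ≢ u × x ≢ v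

    classify : ∀ x → Σ Part (Spec x)
    classify x with x ≟ u | x ≟ v | adj? H u x | any? (λ w → adj? H u w ×-dec adj? H w x)
    ... | yes x≡u | _       | _      | _       = U , x≡u
    ... | no x≢u  | yes x≡v | _      | _       = V , x≡v , x≢u
    ... | no x≢u  | no x≢v  | yes ux | _       = A , ux , x≢u , x≢v
    ... | no x≢u  | no x≢v  | no ¬ux | yes uwx = C , ¬ux , uwx , x≢u , x≢v
    ... | no x≢u  | no x≢v  | no ¬ux | no ¬uwx = B , ¬ux , ¬uwx , x≢u , x≢v

    part : Fin n → Part
    part x = proj₁ (classify x)

    spec : ∀ {x X} → part x ≡ X → Spec x X
    spec {x} eq = subst (Spec x) eq (proj₂ (classify x))

    part-u : part u ≡ U
    part-u with classify u
    ... | U , _ = refl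
    ... | V , _ , u≢u             = ⊥-elim (u≢u refl)
    ... | A , _ , u≢u , _         = ⊥-elim (u≢u refl)
    ... | B , _ , _ , u≢u , _     = ⊥-elim (u≢u refl)
    ... | C , _ , _ , u≢u , _     = ⊥-elim (u≢u refl)

    part-v : part v ≡ V
    part-v with classify v
    ... | U , v≡u = ⊥-elim (far (inj₁ (inj₁ (sym v≡u))))
    ... | V , _ = refl
    ... | A , _ , _ , v≢v         = ⊥-elim (v≢v refl)
    ... | B , _ , _ , _ , v≢v     = ⊥-elim (v≢v refl)
    ... | C , _ , _ , _ , v≢v     = ⊥-elim (v≢v refl)

    neighbour-v-in-B : part (proj₁ (neighbour v)) ≡ B
    neighbour-v-in-B with neighbour v
    ... | z , vz with classify z
    ...   | U , refl                   = ⊥-elim (far (inj₁ (inj₂ (inj₁ (adj-sym H {v} {u} vz)))))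
    ...   | V , refl , _               = ⊥-elim (adj⇒≢ H {v} {v} vz refl)
    ...   | A , uz , _                 = ⊥-elim (far (inj₁ (inj₂ (inj₂ (z , uz , adj-sym H {v} {z} vz)))))
    ...   | C , _ , (w , uw , wz) , _  = ⊥-elim (far (inj₂ (w , z , uw , wz , adj-sym H {v} {z} vz)))
    ...   | B , _                      = refl

    neighbour-u-in-A : part (proj₁ (neighbour u)) ≡ A
    neighbour-u-in-A with neighbour u
    ... | z , uz with classify z
    ...   | U , refl                   = ⊥-elim (adj⇒≢ H {u} {u} uz refl)
    ...   | V , refl , _               = ⊥-elim (far (inj₁ (inj₂ (inj₁ uz))))
    ...   | A , _                      = refl
    ...   | B , ¬uz , _                = ⊥-elim (¬uz uz)
    ...   | C , ¬uz , _                = ⊥-elim (¬uz uz)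

  frame : Frame G
  frame = record
    { u = u ; v = v ; part = part
    ; U⇒≡u = spec
    ; V⇒≡v = proj₁ ∘ spec
    ; part-u = part-u ; part-v = part-v
    ; adj-uv = ¬complement⇒adj G (far ∘ inj₁ ∘ inj₁) (far ∘ inj₁ ∘ inj₂ ∘ inj₁)
    ; adj-Av = λ {x} px → let (ux , _ , x≢v) = spec px in
        ¬complement⇒adj G x≢v λ xv → far (inj₁ (inj₂ (inj₂ (x , ux , xv))))
    ; adj-AB = λ {x} {y} px py → let (ux , _ , _) = spec px ; (¬uy , ¬uwy , _) = spec py in
        ¬complement⇒adj G (λ { refl → ¬uy ux }) λ xy → ¬uwy (x , ux , xy)
    ; adj-Bu = λ {y} py → let (¬uy , _ , y≢u , _) = spec py in
        ¬complement⇒adj G y≢u (¬uy ∘ adj-sym H {y} {u})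
    ; adj-Cu = λ {z} pz → let (¬uz , _ , z≢u , _) = spec pz in
        ¬complement⇒adj G z≢u (¬uz ∘ adj-sym H {z} {u})
    ; adj-Cv = λ pz → let (_ , (w , uw , wz) , _ , z≢v) = spec pz in
        ¬complement⇒adj G z≢v λ zv → far (inj₂ (w , _ , uw , wz , zv))
    ; two-A⇒B = λ _ _ _ → proj₁ (neighbour v) , neighbour-v-in-B
    ; two-B⇒A = λ _ _ _ → proj₁ (neighbour u) , neighbour-u-in-A
    }

other-than : ∀ {n} → 2 ≤ n → (u : Fin n) → ∃ λ w → w ≢ u
other-than (s≤s (s≤s _)) zero    = suc zero , λ ()
other-than (s≤s (s≤s _)) (suc _) = zero , λ ()

has-edge : ∀ {n} {K : Graph n} → 2 ≤ n → Connected K → ∃₂ λ x y → Adj K x y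
has-edge {K = K} (s≤s (s≤s _)) K-conn with K-conn zero (suc zero)
... | _ , step xy _ , _ = _ , _ , xy

no-isolated⇒neighbour : ∀ {n} {K : Graph n} → ¬ (∃ λ u → Isolated K u) → ∀ x → ∃ λ y → Adj K x y
no-isolated⇒neighbour {K = K} ¬iso x =
  decidable-stable (any? (adj? K x)) λ ¬nb → ¬iso (x , λ y xy → ¬nb (y , xy))

isolated⇒twoComponentsOneTrivial : ∀ {n} {K : Graph n} {u w} → w ≢ u → Isolated K u →
                                   (∀ x y → x ≢ u → y ≢ u → Within₂ K x y) → TwoComponentsOneTrivial K
isolated⇒twoComponentsOneTrivial {K = K} {u} {w} w≢u u-iso near =
  u , w , (w≢u ∘ isolated-reach u-iso) , cover , λ _ → isolated-reach u-iso
  where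
  cover : ∀ x → Reach K u x ⊎ Reach K w x
  cover x with x ≟ u
  ... | yes refl = inj₁ (_ , path₀ K u)
  ... | no x≢u   = inj₂ (dist⇒reach K (proj₁ (proj₂ (within₂⇒dist K (near w x w≢u x≢u)))))

no-isolated⇒¬twoComponentsOneTrivial : ∀ {n} {K : Graph n} → (∀ x → ∃ λ y → Adj K x y) →
                                        ¬ TwoComponentsOneTrivial K
no-isolated⇒¬twoComponentsOneTrivial {K = K} neighbour (a , _ , _ , _ , trivial)
  with y , ay ← neighbour a = adj⇒≢ K ay (sym (trivial y (_ , path₁ K ay)))

within₃⇒diam : ∀ {n} {K : Graph n} {x y} → x ≢ y → ¬ Adj K x y → (∀ x y → Within₃ K x y) →
               Connected K × (Diam K 2 ⊎ Diam K 3)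
within₃⇒diam {K = K} {x} {y} x≢y ¬xy near = connected , diam
  where
  connected : Connected K
  connected p q = dist⇒reach K (proj₁ (proj₂ (within₃⇒dist K (near p q))))
  diam : Diam K 2 ⊎ Diam K 3
  diam with any? (λ p → any? (λ q → ¬? (within₂? K p q)))
  ... | yes (p , q , far) with near p q
  ...   | inj₁ near₂ = ⊥-elim (far near₂)
  ...   | inj₂ walk  = inj₂ ((λ p q → within₃⇒dist K (near p q)) , p , q , dist-3 K far walk)
  diam | no ¬far with decidable-stable (within₂? K x y) (λ far → ¬far (x , y , far))
  ... | inj₁ x≡y        = ⊥-elim (x≢y x≡y)
  ... | inj₂ (inj₁ xy)  = ⊥-elim (¬xy xy)
  ... | inj₂ (inj₂ xwy) = inj₁ ((λ p q → within₂⇒dist K (near₂ p q)) , x , y , dist-2 K [ x≢y , ¬xy ]′ xwy)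
    where
    near₂ : ∀ p q → Within₂ K p q
    near₂ p q = decidable-stable (within₂? K p q) λ far → ¬far (p , q , far)

isolated-case : ∀ {n} (G : Graph n) → 2 ≤ n → ¬ TwoComponentsOneTrivial (complement G) →
                ∀ u → Isolated (complement G) u → RainbowConnectable G 4
isolated-case G 2≤n ¬twoComponents u u-iso
  with any? (λ v → any? (λ a → ¬? (v ≟ u) ×-dec ¬? (a ≟ u) ×-dec ¬? (within₂? (complement G) v a)))
... | yes (v , a , v≢u , a≢u , far) =
  frame-rainbowConnectable (IsolatedVertex.frame G u u-iso v a v≢u a≢u far)
... | no ¬far = ⊥-elim (¬twoComponents (isolated⇒twoComponentsOneTrivial (proj₂ (other-than 2≤n u)) u-iso
      λ v a v≢u a≢u → decidable-stable (within₂? (complement G) v a) λ far → ¬far (v , a , v≢u , a≢u , far)))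

no-isolated-case : ∀ {n} (G : Graph n) → 2 ≤ n → Connected G →
                   ¬ (Connected (complement G) × (Diam (complement G) 2 ⊎ Diam (complement G) 3)) →
                   ¬ (∃ λ u → Isolated (complement G) u) → RainbowConnectable G 4
no-isolated-case G 2≤n G-connected ¬diam ¬iso
  with any? (λ u → any? (λ v → ¬? (within₃? (complement G) u v)))
... | yes (u , v , far) =
  frame-rainbowConnectable (FarPair.frame G u v far (no-isolated⇒neighbour {K = complement G} ¬iso))
... | no ¬far with x , y , xy ← has-edge 2≤n G-connected =
  ⊥-elim (¬diam (within₃⇒diam (adj⇒≢ G xy) ¬xy′
    λ p q → decidable-stable (within₃? (complement G) p q) λ far → ¬far (p , q , far)))
  where
  ¬xy′ : ¬ Adj (complement G) x y
  ¬xy′ xy′ with () ← trans (sym xy) (complement-adj⁻ G xy′)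

rainbowConnectable-4 : ∀ {n} (G : Graph n) → 2 ≤ n → Connected G → ComplementHyp G → RainbowConnectable G 4
rainbowConnectable-4 G 2≤n G-connected (¬diam , ¬twoComponents)
  with any? (λ u → all? (λ x → ¬? (adj? (complement G) u x)))
... | yes (u , u-iso) = isolated-case G 2≤n ¬twoComponents u u-iso
... | no ¬iso         = no-isolated-case G 2≤n G-connected ¬diam ¬iso

xor≡true : ∀ a b → a xor b ≡ true → b ≡ not a
xor≡true false true  _ = refl
xor≡true true  false _ = refl

xor≡false : ∀ a b → a xor b ≡ false → a ≡ b
xor≡false false false _ = refl
xor≡false true  true  _ = refl

-- The complete bipartite graph K_{2,m}; its first two vertices form the small side.
small : ∀ {m} → Fin (2 + m) → Bool
small zero          = true
small (suc zero)    = true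
small (suc (suc _)) = false

K₂ : ∀ m → Graph (2 + m)
K₂ m = record
  { adj    = λ x y → small x xor small y
  ; adjSym = λ x y → xor-comm (small x) (small y)
  ; adjIrr = λ x → xor-same (small x)
  }

K₂-edge : ∀ {m b} {x y : Fin (2 + m)} → small x ≡ b → Adj (K₂ m) x y → small y ≡ not b
K₂-edge {x = x} {y} refl = xor≡true (small x) (small y)

opposite : ∀ {m} → Fin (2 + suc m) → Fin (2 + suc m)
opposite zero          = suc (suc zero)
opposite (suc zero)    = suc (suc zero)
opposite (suc (suc _)) = zero

opposite-adj : ∀ {m} (x y : Fin (2 + suc m)) → small x ≡ small y → Adj (K₂ (suc m)) (opposite x) y
opposite-adj zero          _ eq = sym eq
opposite-adj (suc zero)    _ eq = sym eq
opposite-adj (suc (suc _)) _ eq = cong not (sym eq)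

K₂-connected : ∀ {m} → Connected (K₂ (suc m))
K₂-connected {m} x y with x ≟ y | small x xor small y in xy
... | yes refl | _     = _ , path₀ (K₂ (suc m)) x
... | no _     | true  = _ , path₁ (K₂ (suc m)) {x} {y} xy
... | no x≢y   | false = _ , path₂ (K₂ (suc m)) {m = opposite x}
                               (adj-sym (K₂ (suc m)) {opposite x} {x} (opposite-adj x x refl))
                               (opposite-adj x y (xor≡false _ _ xy)) x≢y

complement-K₂-side : ∀ {m x y} → Adj (complement (K₂ m)) x y → small x ≡ small y
complement-K₂-side {m} {x} {y} xy = xor≡false (small x) (small y) (complement-adj⁻ (K₂ m) {x} {y} xy)

walk-complement-K₂-side : ∀ {m x y ps} → Walk (complement (K₂ m)) x y ps → small x ≡ small y
walk-complement-K₂-side here = refl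
walk-complement-K₂-side {x = x} (step {w = w} xw walk) =
  trans (complement-K₂-side {x = x} {w} xw) (walk-complement-K₂-side walk)

partner : ∀ {m} → Fin (2 + suc (suc m)) → Fin (2 + suc (suc m))
partner zero                = suc zero
partner (suc zero)          = zero
partner (suc (suc zero))    = suc (suc (suc zero))
partner (suc (suc (suc _))) = suc (suc zero)

complement-partner : ∀ {m} x → Adj (complement (K₂ (suc (suc m)))) x (partner x)
complement-partner zero                = refl
complement-partner (suc zero)          = refl
complement-partner (suc (suc zero))    = refl
complement-partner (suc (suc (suc _))) = refl

K₂-complementHyp : ∀ {m} → ComplementHyp (K₂ (suc (suc m)))
K₂-complementHyp {m} =
  (λ (connected , _) → disconnected (connected zero (suc (suc zero)))) ,
  no-isolated⇒¬twoComponentsOneTrivial (λ x → partner x , complement-partner x)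
  where
  disconnected : ¬ Reach (complement (K₂ (suc (suc m)))) zero (suc (suc zero))
  disconnected (_ , walk , _) with () ← walk-complement-K₂-side walk

K₂-short-walk : ∀ {m t t′ ps} → small {m} t ≡ false → small t′ ≡ false → t ≢ t′ →
                Walk (K₂ m) t t′ ps → len ps ≤ 3 → ∃ λ s → small s ≡ true × ps ≡ t ∷ s ∷ t′ ∷ []
K₂-short-walk st st′ t≢t′ here _ = ⊥-elim (t≢t′ refl)
K₂-short-walk st st′ _ (step tt′ here) _ with () ← trans (sym st′) (K₂-edge st tt′)
K₂-short-walk st st′ _ (step ts (step _ here)) _ = _ , K₂-edge st ts , refl
K₂-short-walk st st′ _ (step ts (step ss′ (step s′t′ here))) _
  with () ← trans (sym st′) (K₂-edge (K₂-edge (K₂-edge st ts) ss′) s′t′)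
K₂-short-walk _ _ _ (step _ (step _ (step _ (step _ here)))) (s≤s (s≤s (s≤s ())))
K₂-short-walk _ _ _ (step _ (step _ (step _ (step _ (step _ _))))) (s≤s (s≤s (s≤s ())))

-- If j² < m, two large-side vertices see the same pair of colours towards the
-- small side; with j ≤ 3 colours a rainbow path between them has length 2 and
-- so passes through the small side, where its two colours coincide.
K₂-rainbow-bound : ∀ {m j} → RainbowConnectable (K₂ m) j → j ≤ 3 → m ≤ j * j
K₂-rainbow-bound {m} {j} (c , rc) j≤3 = ≮⇒≥ collision
  where
  large : Fin m → Fin (2 + m)
  large i = suc (suc i)
  signature : Fin m → Fin (j * j)
  signature i = combine (col c (large i) zero) (col c (large i) (suc zero))
  equal-signatures : ∀ {t t′} → signature t ≡ signature t′ →
                     col c (large t) zero ≡ col c (large t′) zero ×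
                     col c (large t) (suc zero) ≡ col c (large t′) (suc zero)
  equal-signatures {t} {t′} = combine-injective (col c (large t) zero) (col c (large t) (suc zero))
                                                (col c (large t′) zero) (col c (large t′) (suc zero))
  collision : ¬ (j * j ℕ.< m)
  collision j²<m with i , i′ , i<i′ , same ← pigeonhole j²<m signature =
    no-rainbow (<⇒≢ i<i′) same (rc (large i) (large i′))
    where
    no-rainbow : ∀ {t t′} → t ≢ t′ → signature t ≡ signature t′ → ¬ ∃ (RainbowPath c (large t) (large t′))
    no-rainbow t≢t′ same (ps , (walk , _) , colours!)
      with K₂-short-walk refl refl (t≢t′ ∘ suc-injective ∘ suc-injective) walk
             (subst (_≤ 3) (length-colorsOf c ps) (≤-trans (Unique⇒length≤ colours!) j≤3)) | colours!
    ... | zero     , _ , refl | (c₁≢c₂ ∷ []) ∷ _ =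
      c₁≢c₂ (trans (proj₁ (equal-signatures same)) (colSym c _ _))
    ... | suc zero , _ , refl | (c₁≢c₂ ∷ []) ∷ _ =
      c₁≢c₂ (trans (proj₂ (equal-signatures same)) (colSym c _ _))

K₂₁₀-rc≥4 : ∀ j → RainbowConnectable (K₂ 10) j → 4 ≤ j
K₂₁₀-rc≥4 j rc with 4 ≤? j
... | yes 4≤j = 4≤j
... | no 4≰j  = ⊥-elim (<-irrefl refl (≤-trans (K₂-rainbow-bound rc j≤3) (*-mono-≤ j≤3 j≤3)))
  where
  j≤3 : j ≤ 3
  j≤3 = ≤-pred (≰⇒> 4≰j)

theorem1p1 : ((n : ℕ) (G : Graph n) → 2 ≤ n → Connected G → ComplementHyp G
                → ∃[ k ] (IsRC G k × k ≤ 4))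
           × (∃[ n ] ∃[ G ] (2 ≤ n × Connected {n} G × ComplementHyp G × IsRC G 4))
theorem1p1 = rc≤4 , 12 , K₂ 10 , s≤s (s≤s z≤n) , K₂-connected , K₂-complementHyp , rc[K₂₁₀]≡4
  where
  rc≤4 : (n : ℕ) (G : Graph n) → 2 ≤ n → Connected G → ComplementHyp G → ∃[ k ] (IsRC G k × k ≤ 4)
  rc≤4 n G 2≤n connected hyp = rc≤ G (rainbowConnectable-4 G 2≤n connected hyp)
  rc[K₂₁₀]≡4 : IsRC (K₂ 10) 4
  rc[K₂₁₀]≡4 = isRC-exact (rc≤4 12 (K₂ 10) (s≤s (s≤s z≤n)) K₂-connected K₂-complementHyp) K₂₁₀-rc≥4
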